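{- Let $\mathcal{C}\colon y^2=C(x)$ be an elliptic curve over $\mathbb{Q}$ with $C\in\mathbb{Q}[x]$ monic of degree $3$. Assume $\mathcal{C}(\mathbb{Q})$ has rank $0$ and trivial torsion subgroup. Then for every polynomial $B\in\mathbb{Q}[X]$ of degree $\le2$ and every $k\in\mathbb{Z}\setminus\{0\}$, the polynomial $B^2-4k^2C$ is a power of an irreducible polynomial in $\mathbb{Q}[X]$. -}

module Defs where

open import Data.Nat using (ℕ; zero; suc; _≤_)
open import Data.Integer as ℤ using (ℤ)
open import Data.Rational using (ℚ; 0ℚ; 1ℚ; _+_; _*_; _-_; _/_; -_)
open import Data.List using (List; []; _∷_; map)
open import Data.Product using (Σ; _×_; ∃-syntax)
open import Data.Sum using (_⊎_)
open import Relation.Binary.PropositionalEquality using (_≡_; _≢_)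
open import Relation.Nullary using (¬_)

-- Univariate polynomials over ℚ as coefficient lists, lowest degree first.
-- Trailing zeros are allowed; equality is coefficientwise (_≈P_).
Poly : Set
Poly = List ℚ

coeff : Poly → ℕ → ℚ
coeff []      _       = 0ℚ
coeff (a ∷ p) zero    = a
coeff (a ∷ p) (suc n) = coeff p n

_≈P_ : Poly → Poly → Set
p ≈P q = ∀ n → coeff p n ≡ coeff q n

infixl 6 _+P_ _-P_
infixl 7 _*P_ _·P_

_+P_ : Poly → Poly → Poly
[]      +P q       = q
(a ∷ p) +P []      = a ∷ p
(a ∷ p) +P (b ∷ q) = (a + b) ∷ (p +P q)

_·P_ : ℚ → Poly → Poly
c ·P p = map (c *_) p

_-P_ : Poly → Poly → Poly
p -P q = p +P ((- 1ℚ) ·P q)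

_*P_ : Poly → Poly → Poly
[]      *P q = []
(a ∷ p) *P q = (a ·P q) +P (0ℚ ∷ (p *P q))

constP : ℚ → Poly
constP c = c ∷ []

_^P_ : Poly → ℕ → Poly
p ^P zero  = constP 1ℚ
p ^P suc m = p *P (p ^P m)

eval : Poly → ℚ → ℚ
eval []      x = 0ℚ
eval (a ∷ p) x = a + x * eval p x

IsConstant : Poly → Set
IsConstant p = ∀ n → coeff p (suc n) ≡ 0ℚ

Irreducible : Poly → Set
Irreducible q = ¬ IsConstant q × (∀ f g → q ≈P (f *P g) → IsConstant f ⊎ IsConstant g)

IsPowerOfIrreducible : Poly → Set
IsPowerOfIrreducible P =
  ∃[ c ] ∃[ Q ] ∃[ m ] (c ≢ 0ℚ × Irreducible Q × 1 ≤ m × P ≈P (constP c *P (Q ^P m)))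

monicCubic : ℚ → ℚ → ℚ → Poly
monicCubic a b c = c ∷ b ∷ a ∷ 1ℚ ∷ []

q : ℤ → ℚ
q z = z / 1

discCubic : ℚ → ℚ → ℚ → ℚ
discCubic a b c =
  a * a * b * b - q (ℤ.+ 4) * b * b * b - q (ℤ.+ 4) * a * a * a * c
  - q (ℤ.+ 27) * c * c + q (ℤ.+ 18) * a * b * c

IsEllipticCubic : ℚ → ℚ → ℚ → Set
IsEllipticCubic a b c = discCubic a b c ≢ 0ℚ

-- The Mordell–Weil group E(ℚ) is trivial, i.e. E(ℚ) = {O}: no affine
-- rational point (x , y) with y² = C(x).  (For a finitely generated abelian
-- group, "rank 0 and trivial torsion" is exactly triviality.)
TrivialMordellWeil : ℚ → ℚ → ℚ → Set
TrivialMordellWeil a b c = ∀ (x y : ℚ) → y * y ≢ eval (monicCubic a b c) x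

quadPoly : ℚ → ℚ → ℚ → Poly
quadPoly b0 b1 b2 = b0 ∷ b1 ∷ b2 ∷ []

-- With w = 2k the polynomial is P = B² − w²C, of degree at most 4.  A rational root x of P
-- would give the rational point (x , B(x)/w) on y² = C(x), so P has no linear factor.
-- If P = fg with f, g quadratic, then b₂² = f₂g₂, so L = g₂f + f₂g − 2b₂B has no x² term,
-- and comparing the x³ coefficients of P and fg shows that the x coefficient of L is −w² ≠ 0.
-- At the rational root x of L,
--   (g₂f(x) − f₂g(x))² = (g₂f(x) + f₂g(x))² − 4f₂g₂·f(x)g(x) = (2b₂w)²·C(x),
-- again a rational point.  So P is irreducible, in particular the first power of an irreducible.

{-# OPTIONS --safe #-}
module Submission where

open import Defs
open import Data.Integer as ℤ using (ℤ; _*_; 0ℤ)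
open import Data.Rational using (ℚ)
open import Relation.Binary.PropositionalEquality using (_≢_)

open import Data.Rational using (mkℚ; 0ℚ; 1ℚ; _+_; _-_; -_; 1/_; ↥_; ≢-nonZero)
  renaming (_*_ to _·_)
import Data.Rational.Properties as ℚₚ
open import Data.Nat as ℕ using (ℕ; zero; suc; z≤n; s≤s)
import Data.Nat.Properties as ℕₚ
import Data.Nat.Coprimality as Coprimality
open import Data.Product using (_,_; ∃-syntax; proj₁; proj₂)
open import Data.List using ([]; _∷_)
open import Data.Sum using (_⊎_; inj₁; inj₂)
open import Data.Empty using (⊥; ⊥-elim)
open import Function using (_∘_)
open import Level using (0ℓ)
open import Relation.Nullary using (¬_; yes; no)
open import Relation.Nullary.Decidable using (dec⇒maybe; decidable-stable)
open import Relation.Binary.PropositionalEquality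
  using (_≡_; refl; sym; trans; cong; cong₂; subst; module ≡-Reasoning)
open import Tactic.RingSolver using (solve-∀)
open import Tactic.RingSolver.Core.AlmostCommutativeRing
  using (AlmostCommutativeRing; fromCommutativeRing)
open import Algebra.Apartness.Properties.HeytingCommutativeRing ℚₚ.heytingCommutativeRing
  using () renaming (x#0y#0→xy#0 to ·-≢0)
open import Algebra.Properties.Group ℚₚ.+-0-group using () renaming (x∙y⁻¹≈ε⇒x≈y to x-y≡0⇒x≡y)

open ≡-Reasoning

ring : AlmostCommutativeRing 0ℓ 0ℓ
ring = fromCommutativeRing ℚₚ.+-*-commutativeRing (λ x → dec⇒maybe (0ℚ ≟ x))
  where open ℚₚ using (_≟_)

x+x≢0 : ∀ {x} → x ≢ 0ℚ → x + x ≢ 0ℚ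
x+x≢0 {x} x≢0 x+x≡0 = ·-≢0 {1ℚ + 1ℚ} (λ ()) x≢0 (trans (double x) x+x≡0)
  where
  double : ∀ x → (1ℚ + 1ℚ) · x ≡ x + x
  double = solve-∀ ring

coeff-+P : ∀ p r n → coeff (p +P r) n ≡ coeff p n + coeff r n
coeff-+P []      r       n       = sym (ℚₚ.+-identityˡ (coeff r n))
coeff-+P (a ∷ p) []      n       = sym (ℚₚ.+-identityʳ (coeff (a ∷ p) n))
coeff-+P (a ∷ p) (b ∷ r) zero    = refl
coeff-+P (a ∷ p) (b ∷ r) (suc n) = coeff-+P p r n

coeff-·P : ∀ c p n → coeff (c ·P p) n ≡ c · coeff p n
coeff-·P c []      n       = sym (ℚₚ.*-zeroʳ c)
coeff-·P c (a ∷ p) zero    = refl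
coeff-·P c (a ∷ p) (suc n) = coeff-·P c p n

u+-1·v≡u-v : ∀ u v → u + (- 1ℚ) · v ≡ u - v
u+-1·v≡u-v = solve-∀ ring

coeff--P : ∀ p r n → coeff (p -P r) n ≡ coeff p n - coeff r n
coeff--P p r n = begin
  coeff (p +P (- 1ℚ) ·P r) n            ≡⟨ coeff-+P p _ n ⟩
  coeff p n + coeff ((- 1ℚ) ·P r) n     ≡⟨ cong (coeff p n +_) (coeff-·P (- 1ℚ) r n) ⟩
  coeff p n + (- 1ℚ) · coeff r n        ≡⟨ u+-1·v≡u-v (coeff p n) (coeff r n) ⟩
  coeff p n - coeff r n                 ∎

coeff-combination : ∀ p f r g s h n → coeff (p ·P f +P r ·P g -P s ·P h) n
                    ≡ p · coeff f n + r · coeff g n - s · coeff h n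
coeff-combination p f r g s h n = begin
  coeff (p ·P f +P r ·P g -P s ·P h) n
    ≡⟨ coeff--P (p ·P f +P r ·P g) (s ·P h) n ⟩
  coeff (p ·P f +P r ·P g) n - coeff (s ·P h) n
    ≡⟨ cong₂ _-_ (coeff-+P (p ·P f) (r ·P g) n) (coeff-·P s h n) ⟩
  coeff (p ·P f) n + coeff (r ·P g) n - s · coeff h n
    ≡⟨ cong₂ (λ u v → u + v - s · coeff h n) (coeff-·P p f n) (coeff-·P r g n) ⟩
  p · coeff f n + r · coeff g n - s · coeff h n ∎

convolution : (ℕ → ℚ) → (ℕ → ℚ) → ℕ → ℚ
convolution F G zero    = F 0 · G 0
convolution F G (suc n) = F 0 · G (suc n) + convolution (F ∘ suc) G n

convolution-zeroˡ : ∀ {F} G n → (∀ i → F i ≡ 0ℚ) → convolution F G n ≡ 0ℚ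
convolution-zeroˡ G zero    F≡0 rewrite F≡0 0 = ℚₚ.*-zeroˡ (G 0)
convolution-zeroˡ G (suc n) F≡0
  rewrite F≡0 0 | convolution-zeroˡ G n (F≡0 ∘ suc) | ℚₚ.*-zeroˡ (G (suc n)) = refl

coeff-*P : ∀ p r n → coeff (p *P r) n ≡ convolution (coeff p) (coeff r) n
coeff-*P []      r n       = sym (convolution-zeroˡ (coeff r) n (λ _ → refl))
coeff-*P (a ∷ p) r zero    = begin
  coeff (a ·P r +P (0ℚ ∷ p *P r)) 0 ≡⟨ coeff-+P (a ·P r) _ 0 ⟩
  coeff (a ·P r) 0 + 0ℚ             ≡⟨ ℚₚ.+-identityʳ _ ⟩
  coeff (a ·P r) 0                  ≡⟨ coeff-·P a r 0 ⟩
  a · coeff r 0                     ∎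
coeff-*P (a ∷ p) r (suc n) = begin
  coeff (a ·P r +P (0ℚ ∷ p *P r)) (suc n)      ≡⟨ coeff-+P (a ·P r) _ (suc n) ⟩
  coeff (a ·P r) (suc n) + coeff (p *P r) n    ≡⟨ cong₂ _+_ (coeff-·P a r (suc n)) (coeff-*P p r n) ⟩
  a · coeff r (suc n) + convolution (coeff p) (coeff r) n ∎

*P-identityʳ : ∀ p → (p *P constP 1ℚ) ≈P p
*P-identityʳ []      n       = refl
*P-identityʳ (a ∷ p) zero    = trans (ℚₚ.+-identityʳ (a · 1ℚ)) (ℚₚ.*-identityʳ a)
*P-identityʳ (a ∷ p) (suc n) = *P-identityʳ p n

*P-identityˡ : ∀ p → (constP 1ℚ *P p) ≈P p
*P-identityˡ p n = begin
  coeff (1ℚ ·P p +P (0ℚ ∷ [])) n            ≡⟨ coeff-+P (1ℚ ·P p) (0ℚ ∷ []) n ⟩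
  coeff (1ℚ ·P p) n + coeff (0ℚ ∷ []) n     ≡⟨ cong₂ _+_ (coeff-·P 1ℚ p n) (coeff-0ℚ∷[] n) ⟩
  1ℚ · coeff p n + 0ℚ                       ≡⟨ ℚₚ.+-identityʳ _ ⟩
  1ℚ · coeff p n                            ≡⟨ ℚₚ.*-identityˡ _ ⟩
  coeff p n                                 ∎
  where
  coeff-0ℚ∷[] : ∀ n → coeff (0ℚ ∷ []) n ≡ 0ℚ
  coeff-0ℚ∷[] zero    = refl
  coeff-0ℚ∷[] (suc n) = refl

irreducible⇒power-of-irreducible : ∀ p → Irreducible p → IsPowerOfIrreducible p
irreducible⇒power-of-irreducible p p-irreducible =
  1ℚ , p , 1 , ℚₚ.1≢0 , p-irreducible , ℕₚ.≤-refl ,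
  λ n → sym (trans (*P-identityˡ (p *P constP 1ℚ) n) (*P-identityʳ p n))

VanishesAbove : (ℕ → ℚ) → ℕ → Set
VanishesAbove F d = ∀ i → d ℕ.< i → F i ≡ 0ℚ

convolution-top : ∀ d e {F G} → VanishesAbove F d → VanishesAbove G e →
                  convolution F G (d ℕ.+ e) ≡ F d · G e
convolution-top zero zero    F-vanishes G-vanishes = refl
convolution-top zero (suc e) {G = G} F-vanishes G-vanishes
  rewrite convolution-zeroˡ G e (λ i → F-vanishes (suc i) (s≤s z≤n)) = ℚₚ.+-identityʳ _
convolution-top (suc d) e {F} {G} F-vanishes G-vanishes
  rewrite G-vanishes (suc (d ℕ.+ e)) (s≤s (ℕₚ.m≤n+m e d))
        | convolution-top d e (λ i d<i → F-vanishes (suc i) (s≤s d<i)) G-vanishes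
        | ℚₚ.*-zeroʳ (F 0) = ℚₚ.+-identityˡ _

record HasDegree (f : Poly) (d : ℕ) : Set where
  constructor hasDegree
  field
    leading≢0      : coeff f d ≢ 0ℚ
    vanishes-above : VanishesAbove (coeff f) d

leading-coeff-*P : ∀ {f g d e} → HasDegree f d → HasDegree g e →
                   coeff (f *P g) (d ℕ.+ e) ≡ coeff f d · coeff g e
leading-coeff-*P {f} {g} {d} {e} (hasDegree _ f-vanishes) (hasDegree _ g-vanishes) =
  trans (coeff-*P f g (d ℕ.+ e)) (convolution-top d e f-vanishes g-vanishes)

degree-bound : ∀ {p m n} → VanishesAbove (coeff p) m → coeff p n ≢ 0ℚ → n ℕ.≤ m
degree-bound {m = m} {n = n} p-vanishes pₙ≢0 =
  decidable-stable (n ℕ.≤? m) (λ n≰m → pₙ≢0 (p-vanishes n (ℕₚ.≰⇒> n≰m)))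

zero-or-degree : ∀ f → (∀ n → coeff f n ≡ 0ℚ) ⊎ ∃[ d ] HasDegree f d
zero-or-degree []      = inj₁ (λ _ → refl)
zero-or-degree (a ∷ f) with zero-or-degree f
... | inj₂ (d , hasDegree fd≢0 f-vanishes) =
  inj₂ (suc d , hasDegree fd≢0 λ { (suc i) (s≤s d<i) → f-vanishes i d<i })
... | inj₁ f≡0 with a ℚₚ.≟ 0ℚ
...   | yes a≡0 = inj₁ (λ { zero → a≡0 ; (suc n) → f≡0 n })
...   | no  a≢0 = inj₂ (0 , hasDegree a≢0 λ { (suc i) _ → f≡0 i })

constant-or-positive-degree : ∀ f → IsConstant f ⊎ ∃[ d ] HasDegree f (suc d)
constant-or-positive-degree f with zero-or-degree f
... | inj₁ f≡0                  = inj₁ (f≡0 ∘ suc)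
... | inj₂ (zero , hasDegree _ f-vanishes) = inj₁ (λ n → f-vanishes (suc n) (s≤s z≤n))
... | inj₂ (suc d , f-degree)   = inj₂ (d , f-degree)

coeff₃-*P-quadratics : ∀ f g → VanishesAbove (coeff f) 2 → VanishesAbove (coeff g) 2 →
                       coeff (f *P g) 3 ≡ coeff f 1 · coeff g 2 + coeff f 2 · coeff g 1
coeff₃-*P-quadratics f g f-vanishes g-vanishes
  rewrite coeff-*P f g 3 | f-vanishes 3 ℕₚ.≤-refl | g-vanishes 3 ℕₚ.≤-refl =
  drop-zeros (coeff f 0) (coeff f 1) (coeff f 2) (coeff g 0) (coeff g 1) (coeff g 2)
  where
  drop-zeros : ∀ f₀ f₁ f₂ g₀ g₁ g₂ →
               f₀ · 0ℚ + (f₁ · g₂ + (f₂ · g₁ + 0ℚ · g₀)) ≡ f₁ · g₂ + f₂ · g₁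
  drop-zeros = solve-∀ ring

≈P-degree≤1 : ∀ f → VanishesAbove (coeff f) 1 → f ≈P (coeff f 0 ∷ coeff f 1 ∷ [])
≈P-degree≤1 f f-vanishes zero          = refl
≈P-degree≤1 f f-vanishes (suc zero)    = refl
≈P-degree≤1 f f-vanishes (suc (suc n)) = f-vanishes (suc (suc n)) (s≤s (s≤s z≤n))

eval-+P : ∀ p r x → eval (p +P r) x ≡ eval p x + eval r x
eval-+P []      r       x = sym (ℚₚ.+-identityˡ _)
eval-+P (a ∷ p) []      x = sym (ℚₚ.+-identityʳ _)
eval-+P (a ∷ p) (b ∷ r) x rewrite eval-+P p r x = interchange a b x (eval p x) (eval r x)
  where
  interchange : ∀ a b x u v → (a + b) + x · (u + v) ≡ (a + x · u) + (b + x · v)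
  interchange = solve-∀ ring

eval-·P : ∀ c p x → eval (c ·P p) x ≡ c · eval p x
eval-·P c []      x = sym (ℚₚ.*-zeroʳ c)
eval-·P c (a ∷ p) x rewrite eval-·P c p x = factor c a x (eval p x)
  where
  factor : ∀ c a x u → c · a + x · (c · u) ≡ c · (a + x · u)
  factor = solve-∀ ring

eval--P : ∀ p r x → eval (p -P r) x ≡ eval p x - eval r x
eval--P p r x = begin
  eval (p +P (- 1ℚ) ·P r) x          ≡⟨ eval-+P p _ x ⟩
  eval p x + eval ((- 1ℚ) ·P r) x    ≡⟨ cong (eval p x +_) (eval-·P (- 1ℚ) r x) ⟩
  eval p x + (- 1ℚ) · eval r x       ≡⟨ u+-1·v≡u-v (eval p x) (eval r x) ⟩
  eval p x - eval r x                ∎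

eval-*P : ∀ p r x → eval (p *P r) x ≡ eval p x · eval r x
eval-*P []      r x = sym (ℚₚ.*-zeroˡ (eval r x))
eval-*P (a ∷ p) r x
  rewrite eval-+P (a ·P r) (0ℚ ∷ p *P r) x | eval-·P a r x | eval-*P p r x =
  factor a x (eval p x) (eval r x)
  where
  factor : ∀ a x u v → a · v + (0ℚ + x · (u · v)) ≡ (a + x · u) · v
  factor = solve-∀ ring

eval-zero : ∀ p x → (∀ n → coeff p n ≡ 0ℚ) → eval p x ≡ 0ℚ
eval-zero []      x p≡0 = refl
eval-zero (a ∷ p) x p≡0 rewrite p≡0 0 | eval-zero p x (p≡0 ∘ suc) | ℚₚ.*-zeroʳ x = refl

eval-≈P : ∀ p r x → p ≈P r → eval p x ≡ eval r x
eval-≈P []      []      x p≈r = refl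
eval-≈P []      (b ∷ r) x p≈r = sym (eval-zero (b ∷ r) x (sym ∘ p≈r))
eval-≈P (a ∷ p) []      x p≈r = eval-zero (a ∷ p) x p≈r
eval-≈P (a ∷ p) (b ∷ r) x p≈r =
  cong₂ (λ u v → u + x · v) (p≈r 0) (eval-≈P p r x (p≈r ∘ suc))

linear-root : ∀ f → HasDegree f 1 → ∃[ x ] eval f x ≡ 0ℚ
linear-root f (hasDegree f₁≢0 f-vanishes) = x , (begin
  eval f x                            ≡⟨ eval-≈P f (f₀ ∷ f₁ ∷ []) x (≈P-degree≤1 f f-vanishes) ⟩
  f₀ + x · (f₁ + x · 0ℚ)              ≡⟨ expand f₀ f₁ (1/ f₁) ⟩
  f₀ + (- f₀) · (f₁ · 1/ f₁)          ≡⟨ cong (λ u → f₀ + (- f₀) · u) (ℚₚ.*-inverseʳ f₁) ⟩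
  f₀ + (- f₀) · 1ℚ                    ≡⟨ cancel f₀ ⟩
  0ℚ                                  ∎)
  where
  instance _ = ≢-nonZero f₁≢0
  f₀ = coeff f 0
  f₁ = coeff f 1
  x = - f₀ · 1/ f₁
  expand : ∀ f₀ f₁ i → f₀ + (- f₀ · i) · (f₁ + (- f₀ · i) · 0ℚ) ≡ f₀ + (- f₀) · (f₁ · i)
  expand = solve-∀ ring
  cancel : ∀ f₀ → f₀ + (- f₀) · 1ℚ ≡ 0ℚ
  cancel = solve-∀ ring

eval-combination : ∀ p f r g s h x → eval (p ·P f +P r ·P g -P s ·P h) x
                   ≡ p · eval f x + r · eval g x - s · eval h x
eval-combination p f r g s h x = begin
  eval (p ·P f +P r ·P g -P s ·P h) x
    ≡⟨ eval--P (p ·P f +P r ·P g) (s ·P h) x ⟩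
  eval (p ·P f +P r ·P g) x - eval (s ·P h) x
    ≡⟨ cong₂ _-_ (eval-+P (p ·P f) (r ·P g) x) (eval-·P s h x) ⟩
  eval (p ·P f) x + eval (r ·P g) x - s · eval h x
    ≡⟨ cong₂ (λ u v → u + v - s · eval h x) (eval-·P p f x) (eval-·P r g x) ⟩
  p · eval f x + r · eval g x - s · eval h x ∎

root-of-factor : ∀ p f g x → p ≈P (f *P g) → eval f x ≡ 0ℚ ⊎ eval g x ≡ 0ℚ → eval p x ≡ 0ℚ
root-of-factor p f g x p≈fg root = begin
  eval p x               ≡⟨ eval-≈P p (f *P g) x p≈fg ⟩
  eval (f *P g) x        ≡⟨ eval-*P f g x ⟩
  eval f x · eval g x    ≡⟨ product-zero root ⟩
  0ℚ                     ∎
  where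
  product-zero : eval f x ≡ 0ℚ ⊎ eval g x ≡ 0ℚ → eval f x · eval g x ≡ 0ℚ
  product-zero (inj₁ fx≡0) rewrite fx≡0 = ℚₚ.*-zeroˡ (eval g x)
  product-zero (inj₂ gx≡0) rewrite gx≡0 = ℚₚ.*-zeroʳ (eval f x)

balanced-difference-square : ∀ p r F G β Bx w Cx →
  β · β ≡ r · p → p · F + r · G ≡ (β + β) · Bx → F · G ≡ Bx · Bx - (w · w) · Cx →
  (p · F - r · G) · (p · F - r · G) ≡ ((β + β) · w) · ((β + β) · w) · Cx
balanced-difference-square p r F G β Bx w Cx β²≡rp sum product = begin
  (p · F - r · G) · (p · F - r · G)
    ≡⟨ square-of-difference p r F G ⟩
  square (p · F + r · G) - four (r · p) · (F · G)
    ≡⟨ cong (λ s → square s - four (r · p) · (F · G)) sum ⟩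
  square ((β + β) · Bx) - four (r · p) · (F · G)
    ≡⟨ cong₂ (λ t u → square ((β + β) · Bx) - four t · u) (sym β²≡rp) product ⟩
  square ((β + β) · Bx) - four (β · β) · (Bx · Bx - (w · w) · Cx)
    ≡⟨ cancel-B β Bx w Cx ⟩
  ((β + β) · w) · ((β + β) · w) · Cx ∎
  where
  square : ℚ → ℚ
  square s = s · s
  four : ℚ → ℚ
  four t = (t + t) + (t + t)
  square-of-difference : ∀ p r F G → (p · F - r · G) · (p · F - r · G)
    ≡ (p · F + r · G) · (p · F + r · G) - ((r · p + r · p) + (r · p + r · p)) · (F · G)
  square-of-difference = solve-∀ ring
  cancel-B : ∀ β Bx w Cx →
    ((β + β) · Bx) · ((β + β) · Bx) - ((β · β + β · β) + (β · β + β · β)) · (Bx · Bx - (w · w) · Cx)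
      ≡ ((β + β) · w) · ((β + β) · w) · Cx
  cancel-B = solve-∀ ring

no-scaled-point : ∀ {a b c} → TrivialMordellWeil a b c →
                  ∀ x y v → v ≢ 0ℚ → y · y ≢ (v · v) · eval (monicCubic a b c) x
no-scaled-point {a} {b} {c} no-point x y v v≢0 y²≡v²C = no-point x (y · v⁻¹) (begin
  (y · v⁻¹) · (y · v⁻¹)       ≡⟨ regroup₁ y v⁻¹ ⟩
  (y · y) · (v⁻¹ · v⁻¹)       ≡⟨ cong (_· (v⁻¹ · v⁻¹)) y²≡v²C ⟩
  ((v · v) · Cx) · (v⁻¹ · v⁻¹) ≡⟨ regroup₂ v v⁻¹ Cx ⟩
  ((v · v⁻¹) · (v · v⁻¹)) · Cx ≡⟨ cong (λ u → (u · u) · Cx) (ℚₚ.*-inverseʳ v) ⟩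
  (1ℚ · 1ℚ) · Cx              ≡⟨ ℚₚ.*-identityˡ Cx ⟩
  Cx                          ∎)
  where
  instance _ = ≢-nonZero v≢0
  v⁻¹ = 1/ v
  Cx = eval (monicCubic a b c) x
  regroup₁ : ∀ y i → (y · i) · (y · i) ≡ (y · y) · (i · i)
  regroup₁ = solve-∀ ring
  regroup₂ : ∀ v i C → ((v · v) · C) · (i · i) ≡ ((v · i) · (v · i)) · C
  regroup₂ = solve-∀ ring

module _ (a b c : ℚ) (no-point : TrivialMordellWeil a b c) (b0 b1 b2 w : ℚ) (w≢0 : w ≢ 0ℚ) where
  private
    B C P : Poly
    B = quadPoly b0 b1 b2
    C = monicCubic a b c
    P = B *P B -P (w · w) ·P C

    coeff₃-P : coeff P 3 ≡ (b1 · b2 + b2 · b1) - w · w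
    coeff₃-P = cubic-term (b1 · b2 + b2 · b1) (w · w)
      where
      cubic-term : ∀ u K → u + (- 1ℚ) · (K · 1ℚ) ≡ u - K
      cubic-term = solve-∀ ring

    P-vanishes-above-4 : VanishesAbove (coeff P) 4
    P-vanishes-above-4 _ (s≤s (s≤s (s≤s (s≤s (s≤s _))))) = refl

    -w²≢0 : 0ℚ - w · w ≢ 0ℚ
    -w²≢0 -w²≡0 = ·-≢0 w≢0 w≢0 (sym (x-y≡0⇒x≡y 0ℚ (w · w) -w²≡0))

    P-nonconstant : ¬ IsConstant P
    P-nonconstant P-constant with b2 ℚₚ.≟ 0ℚ
    ... | no  b2≢0 = ·-≢0 b2≢0 b2≢0 (P-constant 3)
    ... | yes refl = -w²≢0 (begin
      0ℚ - w · w                          ≡⟨ sym (vanishing-b2 b1 (w · w)) ⟩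
      (b1 · 0ℚ + 0ℚ · b1) - w · w         ≡⟨ sym coeff₃-P ⟩
      coeff P 3                           ≡⟨ P-constant 2 ⟩
      0ℚ                                  ∎)
      where
      vanishing-b2 : ∀ b1 K → (b1 · 0ℚ + 0ℚ · b1) - K ≡ 0ℚ - K
      vanishing-b2 = solve-∀ ring

    eval-P : ∀ x → eval P x ≡ eval B x · eval B x - (w · w) · eval C x
    eval-P x = begin
      eval P x                                      ≡⟨ eval--P (B *P B) ((w · w) ·P C) x ⟩
      eval (B *P B) x - eval ((w · w) ·P C) x       ≡⟨ cong₂ _-_ (eval-*P B B x) (eval-·P (w · w) C x) ⟩
      eval B x · eval B x - (w · w) · eval C x      ∎

    P-has-no-root : ∀ x → eval P x ≢ 0ℚ
    P-has-no-root x Px≡0 = no-scaled-point {a} {b} {c} no-point x (eval B x) w w≢0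
      (x-y≡0⇒x≡y _ _ (trans (sym (eval-P x)) Px≡0))

    degree-sum≤4 : ∀ {f g d e} → P ≈P (f *P g) → HasDegree f d → HasDegree g e → d ℕ.+ e ℕ.≤ 4
    degree-sum≤4 {d = d} {e = e} P≈fg f-degree g-degree =
      degree-bound {P} P-vanishes-above-4
        (subst (_≢ 0ℚ) (sym (trans (P≈fg (d ℕ.+ e)) (leading-coeff-*P f-degree g-degree)))
          (·-≢0 (HasDegree.leading≢0 f-degree) (HasDegree.leading≢0 g-degree)))

    no-linear-factor : ∀ {f g} → P ≈P (f *P g) → HasDegree f 1 ⊎ HasDegree g 1 → ⊥
    no-linear-factor {f} {g} P≈fg (inj₁ f-linear) =
      let x , fx≡0 = linear-root f f-linear in P-has-no-root x (root-of-factor P f g x P≈fg (inj₁ fx≡0))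
    no-linear-factor {f} {g} P≈fg (inj₂ g-linear) =
      let x , gx≡0 = linear-root g g-linear in P-has-no-root x (root-of-factor P f g x P≈fg (inj₂ gx≡0))

    leading-coefficients : ∀ {f g} → P ≈P (f *P g) → HasDegree f 2 → HasDegree g 2 →
                           b2 · b2 ≡ coeff f 2 · coeff g 2
    leading-coefficients P≈fg f-quadratic g-quadratic =
      trans (P≈fg 4) (leading-coeff-*P f-quadratic g-quadratic)

    balance : Poly → Poly → Poly
    balance f g = coeff g 2 ·P f +P coeff f 2 ·P g -P (b2 + b2) ·P B

    coeff-balance : ∀ f g n → coeff (balance f g) n
                    ≡ coeff g 2 · coeff f n + coeff f 2 · coeff g n - (b2 + b2) · coeff B n
    coeff-balance f g = coeff-combination (coeff g 2) f (coeff f 2) g (b2 + b2) B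

    eval-balance : ∀ f g x → eval (balance f g) x
                   ≡ coeff g 2 · eval f x + coeff f 2 · eval g x - (b2 + b2) · eval B x
    eval-balance f g = eval-combination (coeff g 2) f (coeff f 2) g (b2 + b2) B

    balance-coeff₁ : ∀ {f g} → P ≈P (f *P g) → HasDegree f 2 → HasDegree g 2 →
                     coeff (balance f g) 1 ≡ 0ℚ - w · w
    balance-coeff₁ {f} {g} P≈fg (hasDegree _ f-vanishes) (hasDegree _ g-vanishes) = begin
      coeff (balance f g) 1
        ≡⟨ coeff-balance f g 1 ⟩
      g₂ · f₁ + f₂ · g₁ - (b2 + b2) · b1
        ≡⟨ cong (λ u → u + f₂ · g₁ - (b2 + b2) · b1) (ℚₚ.*-comm g₂ f₁) ⟩
      f₁ · g₂ + f₂ · g₁ - (b2 + b2) · b1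
        ≡⟨ cong (_- (b2 + b2) · b1) (sym x³-coefficient) ⟩
      ((b1 · b2 + b2 · b1) - w · w) - (b2 + b2) · b1
        ≡⟨ cancel-b1 b1 b2 (w · w) ⟩
      0ℚ - w · w ∎
      where
      f₁ = coeff f 1
      f₂ = coeff f 2
      g₁ = coeff g 1
      g₂ = coeff g 2
      x³-coefficient : (b1 · b2 + b2 · b1) - w · w ≡ f₁ · g₂ + f₂ · g₁
      x³-coefficient = trans (sym coeff₃-P) (trans (P≈fg 3) (coeff₃-*P-quadratics f g f-vanishes g-vanishes))
      cancel-b1 : ∀ b1 b2 K → ((b1 · b2 + b2 · b1) - K) - (b2 + b2) · b1 ≡ 0ℚ - K
      cancel-b1 = solve-∀ ring

    balance-coeff₂ : ∀ {f g} → P ≈P (f *P g) → HasDegree f 2 → HasDegree g 2 →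
                     coeff (balance f g) 2 ≡ 0ℚ
    balance-coeff₂ {f} {g} P≈fg f-quadratic g-quadratic = begin
      coeff (balance f g) 2                           ≡⟨ coeff-balance f g 2 ⟩
      g₂ · f₂ + f₂ · g₂ - (b2 + b2) · b2               ≡⟨ double-square g₂ f₂ b2 ⟩
      g₂ · f₂ + f₂ · g₂ - (b2 · b2 + b2 · b2)          ≡⟨ cong (λ u → g₂ · f₂ + f₂ · g₂ - (u + u)) b2²≡f₂g₂ ⟩
      g₂ · f₂ + f₂ · g₂ - (f₂ · g₂ + f₂ · g₂)          ≡⟨ cancel g₂ f₂ ⟩
      0ℚ                                              ∎
      where
      f₂ = coeff f 2
      g₂ = coeff g 2
      b2²≡f₂g₂ : b2 · b2 ≡ f₂ · g₂
      b2²≡f₂g₂ = leading-coefficients P≈fg f-quadratic g-quadratic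
      double-square : ∀ p r β → p · r + r · p - (β + β) · β ≡ p · r + r · p - (β · β + β · β)
      double-square = solve-∀ ring
      cancel : ∀ p r → p · r + r · p - (r · p + r · p) ≡ 0ℚ
      cancel = solve-∀ ring

    balance-linear : ∀ {f g} → P ≈P (f *P g) → HasDegree f 2 → HasDegree g 2 → HasDegree (balance f g) 1
    balance-linear {f} {g} P≈fg f-quadratic g-quadratic =
      hasDegree (-w²≢0 ∘ trans (sym (balance-coeff₁ P≈fg f-quadratic g-quadratic))) vanishes
      where
      vanishes : VanishesAbove (coeff (balance f g)) 1
      vanishes (suc zero)          (s≤s ())
      vanishes (suc (suc zero))    _ = balance-coeff₂ P≈fg f-quadratic g-quadratic
      vanishes (suc (suc (suc n))) _ = begin
        coeff (balance f g) (3 ℕ.+ n)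
          ≡⟨ coeff-balance f g (3 ℕ.+ n) ⟩
        coeff g 2 · coeff f (3 ℕ.+ n) + coeff f 2 · coeff g (3 ℕ.+ n) - (b2 + b2) · 0ℚ
          ≡⟨ cong₂ (λ u v → coeff g 2 · u + coeff f 2 · v - (b2 + b2) · 0ℚ)
                   (HasDegree.vanishes-above f-quadratic _ 2<3+n) (HasDegree.vanishes-above g-quadratic _ 2<3+n) ⟩
        coeff g 2 · 0ℚ + coeff f 2 · 0ℚ - (b2 + b2) · 0ℚ
          ≡⟨ annihilate (coeff g 2) (coeff f 2) (b2 + b2) ⟩
        0ℚ ∎
        where
        2<3+n : 2 ℕ.< 3 ℕ.+ n
        2<3+n = s≤s (s≤s (s≤s z≤n))
        annihilate : ∀ p r β → p · 0ℚ + r · 0ℚ - β · 0ℚ ≡ 0ℚ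
        annihilate = solve-∀ ring

    no-quadratic-factors : ∀ {f g} → P ≈P (f *P g) → HasDegree f 2 → HasDegree g 2 → ⊥
    no-quadratic-factors {f} {g} P≈fg f-quadratic g-quadratic =
      no-scaled-point {a} {b} {c} no-point x (g₂ · eval f x - f₂ · eval g x) ((b2 + b2) · w) v≢0
        (balanced-difference-square g₂ f₂ (eval f x) (eval g x) b2 (eval B x) w (eval C x)
          b2²≡f₂g₂ sum product)
      where
      f₂ = coeff f 2
      g₂ = coeff g 2
      b2²≡f₂g₂ : b2 · b2 ≡ f₂ · g₂
      b2²≡f₂g₂ = leading-coefficients P≈fg f-quadratic g-quadratic
      v≢0 : (b2 + b2) · w ≢ 0ℚ
      v≢0 = ·-≢0 (x+x≢0 b2≢0) w≢0
        where
        b2≢0 : b2 ≢ 0ℚ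
        b2≢0 b2≡0 = ·-≢0 (HasDegree.leading≢0 f-quadratic) (HasDegree.leading≢0 g-quadratic)
          (trans (sym b2²≡f₂g₂) (cong (λ u → u · u) b2≡0))
      root : ∃[ x ] eval (balance f g) x ≡ 0ℚ
      root = linear-root (balance f g) (balance-linear P≈fg f-quadratic g-quadratic)
      x : ℚ
      x = proj₁ root
      sum : g₂ · eval f x + f₂ · eval g x ≡ (b2 + b2) · eval B x
      sum = x-y≡0⇒x≡y _ _ (trans (sym (eval-balance f g x)) (proj₂ root))
      product : eval f x · eval g x ≡ eval B x · eval B x - (w · w) · eval C x
      product = trans (sym (eval-*P f g x)) (trans (sym (eval-≈P P (f *P g) x P≈fg)) (eval-P x))

    no-proper-factorisation : ∀ {f g} d e → P ≈P (f *P g) → HasDegree f (suc d) → HasDegree g (suc e) → ⊥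
    no-proper-factorisation {f} {g} zero    e    P≈fg f-degree g-degree =
      no-linear-factor {f} {g} P≈fg (inj₁ f-degree)
    no-proper-factorisation {f} {g} (suc d) zero P≈fg f-degree g-degree =
      no-linear-factor {f} {g} P≈fg (inj₂ g-degree)
    no-proper-factorisation (suc zero)    (suc zero)    P≈fg f-degree g-degree =
      no-quadratic-factors P≈fg f-degree g-degree
    no-proper-factorisation (suc zero)    (suc (suc e)) P≈fg f-degree g-degree =
      ℕₚ.≤⇒≯ (degree-sum≤4 P≈fg f-degree g-degree) (ℕₚ.+-monoʳ-≤ 2 (ℕₚ.m≤m+n 3 e))
    no-proper-factorisation (suc (suc d)) (suc e)       P≈fg f-degree g-degree =
      ℕₚ.≤⇒≯ (degree-sum≤4 P≈fg f-degree g-degree) (ℕₚ.+-mono-≤ (ℕₚ.m≤m+n 3 d) (ℕₚ.m≤m+n 2 e))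

  B²-w²C-irreducible : Irreducible (quadPoly b0 b1 b2 *P quadPoly b0 b1 b2 -P (w · w) ·P monicCubic a b c)
  B²-w²C-irreducible = P-nonconstant , proper-factor-constant
    where
    proper-factor-constant : ∀ f g → P ≈P (f *P g) → IsConstant f ⊎ IsConstant g
    proper-factor-constant f g P≈fg with constant-or-positive-degree f | constant-or-positive-degree g
    ... | inj₁ f-constant      | _                   = inj₁ f-constant
    ... | inj₂ _               | inj₁ g-constant     = inj₂ g-constant
    ... | inj₂ (d , f-degree)  | inj₂ (e , g-degree) =
      ⊥-elim (no-proper-factorisation d e P≈fg f-degree g-degree)

coprime-to-1 : ∀ n → Coprimality.Coprime n 1
coprime-to-1 n = Coprimality.sym (Coprimality.1-coprimeTo n)

q-mkℚ : ∀ z → q z ≡ mkℚ z 0 (coprime-to-1 ℤ.∣ z ∣)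
q-mkℚ (ℤ.+ n)    = ℚₚ.normalize-coprime (coprime-to-1 n)
q-mkℚ ℤ.-[1+ n ] = cong -_ (ℚₚ.normalize-coprime (coprime-to-1 (suc n)))

q-homo-* : ∀ m n → q (m * n) ≡ q m · q n
q-homo-* m n rewrite q-mkℚ m | q-mkℚ n = refl

q-≢0 : ∀ {k} → k ≢ 0ℤ → q k ≢ 0ℚ
q-≢0 {k} k≢0 qk≡0 = k≢0 (trans (sym (cong ↥_ (q-mkℚ k))) (cong ↥_ qk≡0))

corollary3p4 : (a b c : ℚ) → IsEllipticCubic a b c → TrivialMordellWeil a b c →
    (b0 b1 b2 : ℚ) (k : ℤ) → k ≢ ℤ.0ℤ →
      IsPowerOfIrreducible ((quadPoly b0 b1 b2 *P quadPoly b0 b1 b2) -P (q ((ℤ.+ 4) * k * k) ·P monicCubic a b c))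
corollary3p4 a b c _ no-point b0 b1 b2 k k≢0 =
  subst (IsPowerOfIrreducible ∘ B²-KC) (sym 4k²≡w²)
    (irreducible⇒power-of-irreducible (B²-KC (w · w))
      (B²-w²C-irreducible a b c no-point b0 b1 b2 w (x+x≢0 (q-≢0 k≢0))))
  where
  B²-KC : ℚ → Poly
  B²-KC K = quadPoly b0 b1 b2 *P quadPoly b0 b1 b2 -P K ·P monicCubic a b c
  w : ℚ
  w = q k + q k
  -- q (ℤ.+ 4) and (1ℚ + 1ℚ) + (1ℚ + 1ℚ) have the same normal form.
  four-squared : ∀ x → ((1ℚ + 1ℚ) + (1ℚ + 1ℚ)) · x · x ≡ (x + x) · (x + x)
  four-squared = solve-∀ ring
  4k²≡w² : q (ℤ.+ 4 * k * k) ≡ w · w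
  4k²≡w² = begin
    q (ℤ.+ 4 * k * k)       ≡⟨ q-homo-* (ℤ.+ 4 * k) k ⟩
    q (ℤ.+ 4 * k) · q k     ≡⟨ cong (_· q k) (q-homo-* (ℤ.+ 4) k) ⟩
    q (ℤ.+ 4) · q k · q k   ≡⟨ four-squared (q k) ⟩
    w · w                   ∎
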